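{- Let $G$ be a finite group with $|G|\geq 3$, and let $S$ be a generating set of $G$ (with $e\notin S$) such that the undirected Cayley graph $\Gamma(G,S)$ is a complete graph. Then Player 1 has a winning strategy for $\texttt{REL}(G,S)$. Player 1 has a winning strategy for $\texttt{RAV}(G,S)$ if $|G|$ is even, and Player 2 has a winning strategy for $\texttt{RAV}(G,S)$ if $|G|$ is odd.
   Context: Games $\texttt{REL}(G,S)$ and $\texttt{RAV}(G,S)$: $G$ is a finite group and $S$ a generating set with $e\notin S$. Two players alternate turns, Player 1 first, starting from the empty word $w_0$. On turn $n$ the current player chooses $s_n\in S\cup S^{ -1}$, subject to $s_n\neq s_{n-1}^{ -1}$ when $n>1$, and forms $w_n=w_{n-1}s_n$. If $w_n$ represents the same element of $G$ as some $w_k$ with $0\le k<n$, the game ends: the player who formed $w_n$ wins $\texttt{REL}(G,S)$ and loses $\texttt{RAV}(G,S)$. If a player has no legal move, that player loses. The undirected Cayley graph $\Gamma(G,S)$ has vertex set $G$, with $g$ and $h$ adjacent whenever $h=gs$ for some $s\in S$. -}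

module Defs where

open import Level using (0ℓ)
open import Data.Nat using (ℕ)
open import Data.Fin using (Fin)
open import Data.Fin.Subset using (Subset; _∈_; _∉_)
open import Data.List using (List; []; _∷_; tails; foldr)
open import Data.List.Relation.Unary.All using (All)
open import Data.List.Relation.Unary.Any using (Any)
open import Data.Product using (Σ; ∃; _×_; _,_)
open import Data.Sum using (_⊎_)
open import Data.Unit using (⊤)
open import Data.Empty using (⊥)
open import Relation.Nullary using (¬_)
open import Relation.Binary.PropositionalEquality using (_≡_)
open import Algebra.Core using (Op₁; Op₂)
open import Algebra.Structures using (IsGroup)

-- A finite group of order n, represented on the carrier Fin n
-- (every finite group is isomorphic to one of this form).
record FinGroup (n : ℕ) : Set where
  field
    _∙_     : Op₂ (Fin n)
    ε       : Fin n
    _⁻¹     : Op₁ (Fin n)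
    isGroup : IsGroup _≡_ _∙_ ε _⁻¹

data Mode : Set where
  REL RAV : Mode

-- Does the player who creates a repeated element win?
RepeaterWins : Mode → Set
RepeaterWins REL = ⊤
RepeaterWins RAV = ⊥

RepeaterLoses : Mode → Set
RepeaterLoses REL = ⊥
RepeaterLoses RAV = ⊤

module _ {n : ℕ} (G : FinGroup n) (S : Subset n) where
  open FinGroup G

  InSym : Fin n → Set
  InSym s = s ∈ S ⊎ (s ⁻¹) ∈ S

  Generates : Set
  Generates = (g : Fin n) → Σ (List (Fin n)) λ ws →
                All InSym ws × foldr _∙_ ε ws ≡ g

  Adjacent : Fin n → Fin n → Set
  Adjacent g h = Σ (Fin n) λ s → s ∈ S × (h ≡ g ∙ s ⊎ g ≡ h ∙ s)

  CompleteCayley : Set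
  CompleteCayley = (g h : Fin n) → ¬ g ≡ h → Adjacent g h

  -- Game positions: the moves played so far, most recent first
  -- (the list s_k ∷ … ∷ s_1 represents the word w_k = s_1 ⋯ s_k).
  val : List (Fin n) → Fin n
  val []      = ε
  val (s ∷ h) = val h ∙ s

  Legal : List (Fin n) → Fin n → Set
  Legal []      s = InSym s
  Legal (t ∷ h) s = InSym s × ¬ s ≡ t ⁻¹

  -- The word of history (s ∷ h) represents the same element as one of
  -- its proper prefixes w_k (k < length), i.e. the value of some tail of h.
  Repeats : List (Fin n) → Set
  Repeats []      = ⊥
  Repeats (s ∷ h) = Any (λ p → val p ≡ val (s ∷ h)) (tails h)

  mutual
    -- The player to move at (non-terminal) history h has a winning strategy.
    data Win (m : Mode) (h : List (Fin n)) : Set where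
      win : (s : Fin n) → Legal h s →
            (Repeats (s ∷ h) × RepeaterWins m) ⊎ (¬ Repeats (s ∷ h) × Lose m (s ∷ h)) →
            Win m h

    -- The opponent of the player to move at h has a winning strategy
    -- (in particular if the player to move has no legal move).
    data Lose (m : Mode) (h : List (Fin n)) : Set where
      lose : ((s : Fin n) → Legal h s →
               (Repeats (s ∷ h) × RepeaterLoses m) ⊎ (¬ Repeats (s ∷ h) × Win m (s ∷ h))) →
             Lose m h

  Player1Wins Player2Wins : Mode → Set
  Player1Wins m = Win m []
  Player2Wins m = Lose m []

{-# OPTIONS --safe #-}
-- Since Γ(G,S) is complete, from the current vertex a player can move to any
-- other vertex except the one just left.  In REL, Player 1 steps to some
-- g ≠ e; Player 2 cannot repeat (that would need a trivial move or a
-- backtrack) and lands on a third vertex, from which Player 1 returns to e.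
-- In RAV, as long as some vertex is unvisited the player to move can step to
-- it, so a game in which both avoid repetitions visits all |G| vertices, and
-- the player forced to make move number |G| must repeat (or is stuck).  That
-- is Player 2 when |G| is even and Player 1 when |G| is odd.
module Submission where

open import Defs
open import Data.Nat using (ℕ; _≤_)
open import Data.Nat.Divisibility using (_∣_)
open import Data.Fin using (Fin)
open import Data.Fin.Subset using (Subset; _∉_)
open import Data.Product using (_×_)
open import Relation.Nullary using (¬_)

open import Level using (0ℓ)
open import Data.Nat using (zero; suc; _+_; _*_; _<_; z<s; s≤s)
open import Data.Nat.Properties using (≮⇒≥; 1+n≰n; m<m+n; +-suc; +-identityʳ; n≤1+n; ≤-trans; ≤-reflexive)
open import Data.Nat.Divisibility using (divides)
import Data.Fin as Fin
open import Data.Fin.Properties using (_≟_; pigeonhole; ¬∀⟶∃¬; <⇒≢)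
open import Data.Fin.Subset using (_∈_)
open import Data.List using (List; []; _∷_; length; lookup; map; tails)
open import Data.List.Membership.Propositional using () renaming (_∈_ to _∈ₗ_; _∉_ to _∉ₗ_)
open import Data.List.Membership.Propositional.Properties using (∈-lookup)
import Data.List.Membership.DecPropositional as DecMembership
open import Data.List.Relation.Unary.All as All using ([]; _∷_)
open import Data.List.Relation.Unary.All.Properties using (¬Any⇒All¬)
open import Data.List.Relation.Unary.AllPairs using ([]; _∷_)
open import Data.List.Relation.Unary.Any as Any using (here; there; index)
open import Data.List.Relation.Unary.Any.Properties using (lookup-index; map⁺; map⁻)
open import Data.List.Relation.Unary.Unique.Propositional using (Unique)
open import Data.Product using (∃; _,_)
open import Data.Sum using (_⊎_; inj₁; inj₂)
open import Data.Unit using (⊤; tt)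
open import Function using (_∘_)
open import Relation.Nullary using (yes; no; contradiction)
open import Relation.Binary.PropositionalEquality
open import Algebra.Bundles using (Group)
open import Algebra.Structures using (IsGroup)
import Algebra.Properties.Group as GroupProperties
import Algebra.Properties.Monoid as MonoidProperties

Unique⇒lookup≢ : {A : Set} {xs : List A} → Unique xs →
                 ∀ {i j} → i Fin.< j → lookup xs i ≢ lookup xs j
Unique⇒lookup≢ {xs = _ ∷ _} (x≢xs ∷ _) {Fin.zero}  {Fin.suc j} _ = All.lookup x≢xs (∈-lookup j)
Unique⇒lookup≢ {xs = _ ∷ _} (_ ∷ u)    {Fin.suc i} {Fin.suc j} (s≤s i<j) = Unique⇒lookup≢ u i<j

Unique⇒length≤ : {n : ℕ} {xs : List (Fin n)} → Unique xs → length xs ≤ n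
Unique⇒length≤ {xs = xs} u = ≮⇒≥ λ n<len →
  let i , j , i<j , same = pigeonhole n<len (lookup xs) in Unique⇒lookup≢ u i<j same

length<⇒∃∉ : {n : ℕ} {xs : List (Fin n)} → length xs < n → ∃ λ v → v ∉ₗ xs
length<⇒∃∉ {n} {xs} len<n = ¬∀⟶∃¬ n (_∈ₗ xs) (_∈? xs) not-all
  where
  open DecMembership (_≟_ {n}) using (_∈?_)
  not-all : ¬ (∀ v → v ∈ₗ xs)
  not-all v∈xs =
    let i , j , i<j , same = pigeonhole len<n (index ∘ v∈xs) in
    <⇒≢ i<j (begin
      i                           ≡⟨ lookup-index (v∈xs i) ⟩
      lookup xs (index (v∈xs i))  ≡⟨ cong (lookup xs) same ⟩
      lookup xs (index (v∈xs j))  ≡⟨ lookup-index (v∈xs j) ⟨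
      j                           ∎)
    where open ≡-Reasoning

¬2∣⇒odd : ∀ {n} → ¬ 2 ∣ n → ∃ λ r → n ≡ suc (r * 2)
¬2∣⇒odd {zero}        ¬2∣n = contradiction (divides 0 refl) ¬2∣n
¬2∣⇒odd {suc zero}    _    = 0 , refl
¬2∣⇒odd {suc (suc n)} ¬2∣n =
  let r , n≡ = ¬2∣⇒odd λ { (divides q n≡q*2) → ¬2∣n (divides (suc q) (cong (suc ∘ suc) n≡q*2)) }
  in suc r , cong (suc ∘ suc) n≡

module _ {n : ℕ} (G : FinGroup n) (S : Subset n) where
  open FinGroup G
  open IsGroup isGroup using (assoc; inverseʳ; _\\_)

  private
    group : Group 0ℓ 0ℓ
    group = record { _≈_ = _≡_ ; _∙_ = _∙_ ; ε = ε ; _⁻¹ = _⁻¹ ; isGroup = isGroup }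

  open GroupProperties group
    using (ε⁻¹≈ε; inverseʳ-unique; \\-leftDividesˡ; \\-leftDividesʳ; ⁻¹-anti-homo-\\; identityʳ-unique)
  open MonoidProperties (Group.monoid group) using (cancelʳ)
  open DecMembership (_≟_ {n}) using (_∈?_)

  InSym⇒≢ε : ε ∉ S → ∀ {s} → InSym G S s → s ≢ ε
  InSym⇒≢ε ε∉S (inj₁ s∈S)  refl = ε∉S s∈S
  InSym⇒≢ε ε∉S (inj₂ s⁻¹∈S) refl = ε∉S (subst (_∈ S) ε⁻¹≈ε s⁻¹∈S)

  complete⇒InSym-\\ : CompleteCayley G S → ∀ {g v} → g ≢ v → InSym G S (g \\ v)
  complete⇒InSym-\\ complete {g} {v} g≢v with complete g v g≢v
  ... | t , t∈S , inj₁ refl = inj₁ (subst (_∈ S) (sym (\\-leftDividesʳ g t)) t∈S)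
  ... | t , t∈S , inj₂ refl =
    inj₂ (subst (_∈ S) (sym (trans (⁻¹-anti-homo-\\ (v ∙ t) v) (\\-leftDividesʳ v t))) t∈S)

  Legal⇒InSym : ∀ h {s} → Legal G S h s → InSym G S s
  Legal⇒InSym []      s∈S±     = s∈S±
  Legal⇒InSym (_ ∷ _) (s∈S± , _) = s∈S±

  Legal⇒val≢ : ε ∉ S → ∀ h {s} → Legal G S h s → val G S (s ∷ h) ≢ val G S h
  Legal⇒val≢ ε∉S h {s} legal same =
    InSym⇒≢ε ε∉S (Legal⇒InSym h legal) (identityʳ-unique (val G S h) s same)

  Legal⇒no-backtrack : ∀ h {t s} → Legal G S (t ∷ h) s → val G S (s ∷ t ∷ h) ≢ val G S h
  Legal⇒no-backtrack h {t} {s} (_ , s≢t⁻¹) same =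
    s≢t⁻¹ (inverseʳ-unique t s (identityʳ-unique (val G S h) (t ∙ s) (trans (sym (assoc _ t s)) same)))

  NotPrevious : List (Fin n) → Fin n → Set
  NotPrevious []      v = ⊤
  NotPrevious (_ ∷ h) v = v ≢ val G S h

  move-to : CompleteCayley G S → ∀ h {v} → v ≢ val G S h → NotPrevious h v →
            ∃ λ s → Legal G S h s × val G S (s ∷ h) ≡ v
  move-to complete [] {v} v≢ε _ =
    ε \\ v , complete⇒InSym-\\ complete (v≢ε ∘ sym) , \\-leftDividesˡ ε v
  move-to complete (t ∷ h) {v} v≢g v≢prev =
    g \\ v , (complete⇒InSym-\\ complete (v≢g ∘ sym) , no-backtrack) , \\-leftDividesˡ g v
    where
    g = val G S (t ∷ h)
    no-backtrack : g \\ v ≢ t ⁻¹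
    no-backtrack s≡t⁻¹ = v≢prev (begin
      v                        ≡⟨ \\-leftDividesˡ g v ⟨
      g ∙ (g \\ v)             ≡⟨ cong (g ∙_) s≡t⁻¹ ⟩
      (val G S h ∙ t) ∙ (t ⁻¹) ≡⟨ cancelʳ (inverseʳ t) (val G S h) ⟩
      val G S h                ∎)
      where open ≡-Reasoning

  visited : List (Fin n) → List (Fin n)
  visited h = map (val G S) (tails h)

  val∈visited : ∀ h → val G S h ∈ₗ visited h
  val∈visited []      = here refl
  val∈visited (_ ∷ _) = here refl

  Repeats⇒∈visited : ∀ h {s} → Repeats G S (s ∷ h) → val G S (s ∷ h) ∈ₗ visited h
  Repeats⇒∈visited h = map⁺ ∘ Any.map sym

  ∈visited⇒Repeats : ∀ h {s} → val G S (s ∷ h) ∈ₗ visited h → Repeats G S (s ∷ h)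
  ∈visited⇒Repeats h = Any.map sym ∘ map⁻

  Unique-visited-∷ : ∀ h {s} → ¬ Repeats G S (s ∷ h) → Unique (visited h) → Unique (visited (s ∷ h))
  Unique-visited-∷ h ¬rep u = ¬Any⇒All¬ (visited h) (¬rep ∘ ∈visited⇒Repeats h) ∷ u

  ∉visited⇒≢val : ∀ h {v} → v ∉ₗ visited h → v ≢ val G S h
  ∉visited⇒≢val h v∉ refl = v∉ (val∈visited h)

  ∉visited⇒NotPrevious : ∀ h {v} → v ∉ₗ visited h → NotPrevious h v
  ∉visited⇒NotPrevious []      _  = tt
  ∉visited⇒NotPrevious (_ ∷ h) v∉ refl = v∉ (there (val∈visited h))

  fresh-move : CompleteCayley G S → ∀ h → length (visited h) < n →
               ∃ λ s → Legal G S h s × ¬ Repeats G S (s ∷ h)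
  fresh-move complete h unvisited-left =
    let v , v∉ = length<⇒∃∉ unvisited-left
        s , legal , s↦v = move-to complete h (∉visited⇒≢val h v∉) (∉visited⇒NotPrevious h v∉)
    in s , legal , λ rep → v∉ (subst (_∈ₗ visited h) s↦v (Repeats⇒∈visited h rep))

  module _ (ε∉S : ε ∉ S) (complete : CompleteCayley G S) where

    REL-player1-wins : 2 ≤ n → Player1Wins G S REL
    REL-player1-wins 2≤n =
      let s , legal , ¬rep = fresh-move complete [] 2≤n
      in win s legal (inj₂ (¬rep , lose λ t legal-t →
           inj₂ (reply-fresh legal-t , return-to-ε legal legal-t)))
      where
      reply-fresh : ∀ {s t} → Legal G S (s ∷ []) t → ¬ Repeats G S (t ∷ s ∷ [])
      reply-fresh {s} legal-t rep with Repeats⇒∈visited (s ∷ []) rep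
      ... | here same         = Legal⇒val≢ ε∉S (s ∷ []) legal-t same
      ... | there (here same) = Legal⇒no-backtrack [] legal-t same

      return-to-ε : ∀ {s t} → Legal G S [] s → Legal G S (s ∷ []) t → Win G S REL (t ∷ s ∷ [])
      return-to-ε {s} {t} legal legal-t =
        let u , legal-u , u↦ε = move-to complete (t ∷ s ∷ [])
              (Legal⇒no-backtrack [] legal-t ∘ sym) (Legal⇒val≢ ε∉S [] legal ∘ sym)
        in win u legal-u (inj₁ (∈visited⇒Repeats (t ∷ s ∷ []) (there (there (here u↦ε))) , tt))

    mutual
      RAV-lose : ∀ r h → Unique (visited h) → length (visited h) + r * 2 ≡ n → Lose G S RAV h
      RAV-lose r h u count = lose λ s _ → reply s
        where
        reply : ∀ s → (Repeats G S (s ∷ h) × RepeaterLoses RAV)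
                      ⊎ (¬ Repeats G S (s ∷ h) × Win G S RAV (s ∷ h))
        reply s with val G S (s ∷ h) ∈? visited h
        ... | yes ∈visited = inj₁ (∈visited⇒Repeats h ∈visited , tt)
        ... | no  ∉visited = inj₂ (¬rep , continue r count)
          where
          ¬rep : ¬ Repeats G S (s ∷ h)
          ¬rep = ∉visited ∘ Repeats⇒∈visited h
          continue : ∀ r → length (visited h) + r * 2 ≡ n → Win G S RAV (s ∷ h)
          continue zero count = contradiction
            (≤-trans (Unique⇒length≤ (Unique-visited-∷ h ¬rep u))
                     (≤-reflexive (trans (sym count) (+-identityʳ _))))
            1+n≰n
          continue (suc r) count =
            RAV-win r (s ∷ h) (Unique-visited-∷ h ¬rep u)
                    (trans (sym (+-suc (length (visited h)) (suc (r * 2)))) count)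

      RAV-win : ∀ r h → Unique (visited h) → length (visited h) + suc (r * 2) ≡ n → Win G S RAV h
      RAV-win r h u count =
        let s , legal , ¬rep = fresh-move complete h (subst (length (visited h) <_) count (m<m+n _ z<s))
        in win s legal (inj₂ (¬rep , RAV-lose r (s ∷ h) (Unique-visited-∷ h ¬rep u)
                                       (trans (sym (+-suc (length (visited h)) (r * 2))) count)))

    RAV-player1-wins : 2 ∣ n → Player1Wins G S RAV
    RAV-player1-wins (divides zero    n≡0)   = contradiction (subst Fin n≡0 ε) λ ()
    RAV-player1-wins (divides (suc r) n≡r*2) = RAV-win r [] ([] ∷ []) (sym n≡r*2)

    RAV-player2-wins : ¬ 2 ∣ n → Player2Wins G S RAV
    RAV-player2-wins ¬2∣n = let r , n≡ = ¬2∣⇒odd ¬2∣n in RAV-lose r [] ([] ∷ []) (sym n≡)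

theorem2p6 : (n : ℕ) → 3 ≤ n → (G : FinGroup n) → (S : Subset n) →
               FinGroup.ε G ∉ S → Generates G S → CompleteCayley G S →
               Player1Wins G S REL
               × (2 ∣ n → Player1Wins G S RAV)
               × (¬ 2 ∣ n → Player2Wins G S RAV)
theorem2p6 n 3≤n G S ε∉S _ complete =
    REL-player1-wins G S ε∉S complete (≤-trans (n≤1+n 2) 3≤n)
  , RAV-player1-wins G S ε∉S complete
  , RAV-player2-wins G S ε∉S complete
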